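{- Let $\Phi\subseteq\{I,O,Q,U,\mathit{Self}\}$ and let $\mathcal{A}$ be an ABox in $\mathcal{L}_\Phi$. If $O\in\Phi$ or $\mathcal{A}$ contains only assertions of the form $C(a)$, then $\mathcal{A}$ is invariant for $\mathcal{L}_\Phi$-bisimulation: for all interpretations $\mathcal{I},\mathcal{I}'$ between which there exists an $\mathcal{L}_\Phi$-bisimulation, $\mathcal{I}$ is a model of $\mathcal{A}$ iff $\mathcal{I}'$ is a model of $\mathcal{A}$.
   Context: Fix finite sets $\Sigma_C,\Sigma_R,\Sigma_I$ of concept, role and individual names. Roles/concepts of $\mathcal{L}_\Phi$: $r\in\Sigma_R$ roles, $A\in\Sigma_C$ concepts; closed under role constructors $\varepsilon, R\circ S, R\sqcup S, R^*, C?$ and concept constructors $\top,\bot,\neg C,C\sqcap D,C\sqcup D,\forall R.C,\exists R.C$; plus $R^-$ if $I\in\Phi$; $\{a\}$ ($a\in\Sigma_I$) if $O\in\Phi$; $\geq n\,r.C$, $\leq n\,r.C$ if $Q\in\Phi$, and $\geq n\,r^-.C$, $\leq n\,r^-.C$ if $Q,I\in\Phi$; the role $U$ if $U\in\Phi$; $\exists r.\mathit{Self}$ if $\mathit{Self}\in\Phi$. Interpretations are extended in the standard way: composition, union, reflexive-transitive closure, $(C?)^{\mathcal{I}}=\{(x,x):x\in C^{\mathcal{I}}\}$, $\varepsilon^{\mathcal{I}}$ identity, $U^{\mathcal{I}}=(\Delta^{\mathcal{I}})^2$, inverse, Booleans set-theoretically, $\{a\}^{\mathcal{I}}=\{a^{\mathcal{I}}\}$,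 $(\exists r.\mathit{Self})^{\mathcal{I}}=\{x:(x,x)\in r^{\mathcal{I}}\}$, $\forall,\exists$ as usual, $(\geq n\,R.C)^{\mathcal{I}}=\{x:\#\{y:(x,y)\in R^{\mathcal{I}},y\in C^{\mathcal{I}}\}\ge n\}$, similarly $\le n$. An ABox in $\mathcal{L}_\Phi$ is a finite set of assertions of forms $C(a)$, $R(a,b)$, $\neg R(a,b)$, $a=b$, $a\not\doteq b$ ($C$ concept, $R$ role of $\mathcal{L}_\Phi$, $a,b\in\Sigma_I$), satisfied in $\mathcal{I}$ respectively iff $a^{\mathcal{I}}\in C^{\mathcal{I}}$, $(a^{\mathcal{I}},b^{\mathcal{I}})\in R^{\mathcal{I}}$, $(a^{\mathcal{I}},b^{\mathcal{I}})\notin R^{\mathcal{I}}$, $a^{\mathcal{I}}=b^{\mathcal{I}}$, $a^{\mathcal{I}}\ne b^{\mathcal{I}}$; $\mathcal{I}$ is a model if it satisfies all assertions. $Z\subseteq\Delta^{\mathcal{I}}\times\Delta^{\mathcal{I}'}$ is an $\mathcal{L}_\Phi$-bisimulation if for all $a\in\Sigma_I,A\in\Sigma_C,r\in\Sigma_R$, $x,y\in\Delta^{\mathcal{I}}$, $x',y'\in\Delta^{\mathcal{I}'}$: (B1) $Z(a^{\mathcal{I}},a^{\mathcal{I}'})$; (B2) $Z(x,x')\Rightarrow(x\in A^{\mathcal{I}}\iff x'\in A^{\mathcal{I}'})$; (B3) $Z(x,x')\wedge(x,y)\in r^{\mathcal{I}}\Rightarrow\exists y'(Z(y,y')\wedge(x',y')\in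 r^{\mathcal{I}'})$; (B4) $Z(x,x')\wedge(x',y')\in r^{\mathcal{I}'}\Rightarrow\exists y(Z(y,y')\wedge(x,y)\in r^{\mathcal{I}})$; if $I\in\Phi$: (B5),(B6) analogous conditions for predecessors; if $O\in\Phi$: (B7) $Z(x,x')\Rightarrow(x=a^{\mathcal{I}}\iff x'=a^{\mathcal{I}'})$; if $Q\in\Phi$: (B8) $Z(x,x')$ implies for every $r$ a bijection between $r$-successors of $x$ and of $x'$ contained in $Z$; if $Q,I\in\Phi$ also (B9) the same for $r$-predecessors; if $U\in\Phi$: (B10),(B11) $Z$ is total on $\Delta^{\mathcal{I}}$ and surjective onto $\Delta^{\mathcal{I}'}$; if $\mathit{Self}\in\Phi$: (B12) $Z(x,x')\Rightarrow((x,x)\in r^{\mathcal{I}}\iff(x',x')\in r^{\mathcal{I}'})$. -}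

module Defs where

open import Level using (0ℓ)
open import Data.Nat using (ℕ; suc)
open import Data.Fin using (Fin)
open import Data.Bool using (Bool; T)
open import Data.Unit using (⊤)
open import Data.Empty using (⊥)
open import Data.Product using (Σ; Σ-syntax; ∃; _×_)
open import Data.Sum using (_⊎_)
open import Data.List using (List)
open import Data.List.Relation.Unary.All using (All)
open import Relation.Nullary using (¬_)
open import Relation.Binary.PropositionalEquality using (_≡_)
open import Relation.Binary.Construct.Closure.ReflexiveTransitive using (Star)

record Sig : Set where
  field
    nC nR nI : ℕ
  CN : Set
  CN = Fin nC
  RN : Set
  RN = Fin nR
  IN : Set
  IN = Fin nI
open Sig public

-- A set Φ ⊆ {I, O, Q, U, Self}, given by its characteristic function.
record Frag : Set where
  field
    hasI hasO hasQ hasU hasSelf : Bool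
open Frag public

module _ (S : Sig) (Φ : Frag) where

  mutual
    data Role : Set where
      rname   : RN S → Role
      ε       : Role
      _∘ʳ_    : Role → Role → Role
      _⊔ʳ_    : Role → Role → Role
      _*ʳ     : Role → Role
      _?ʳ     : Concept → Role
      _⁻      : Role → {T (hasI Φ)} → Role
      Uʳ      : {T (hasU Φ)} → Role

    data Concept : Set where
      cname     : CN S → Concept
      ⊤ᶜ ⊥ᶜ     : Concept
      ¬ᶜ_       : Concept → Concept
      _⊓_ _⊔_   : Concept → Concept → Concept
      ∀ᶜ ∃ᶜ     : Role → Concept → Concept
      nominal   : IN S → {T (hasO Φ)} → Concept
      ≥ᶜ ≤ᶜ     : {T (hasQ Φ)} → ℕ → RN S → Concept → Concept
      ≥⁻ᶜ ≤⁻ᶜ   : {T (hasQ Φ)} → {T (hasI Φ)} → ℕ → RN S → Concept → Concept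
      ∃Self     : {T (hasSelf Φ)} → RN S → Concept

  data Assertion : Set where
    _⟨_⟩     : Concept → IN S → Assertion
    _⟨_,_⟩   : Role → IN S → IN S → Assertion
    ¬_⟨_,_⟩  : Role → IN S → IN S → Assertion
    _≐_      : IN S → IN S → Assertion
    _≉_      : IN S → IN S → Assertion

  ABox : Set
  ABox = List Assertion

  IsConceptAssertion : Assertion → Set
  IsConceptAssertion (C ⟨ a ⟩) = ⊤
  IsConceptAssertion _ = ⊥

record Interp (S : Sig) : Set₁ where
  field
    Δ     : Set
    conc  : CN S → Δ → Set
    role  : RN S → Δ → Δ → Set
    ind   : IN S → Δ
open Interp public

-- "at least n distinct elements y with P y": an injection Fin n → {y | P y}
AtLeast : {D : Set} → ℕ → (D → Set) → Set
AtLeast {D} n P =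
  Σ[ f ∈ (Fin n → D) ] ((∀ i j → f i ≡ f j → i ≡ j) × (∀ i → P (f i)))

module _ {S : Sig} {Φ : Frag} (𝓘 : Interp S) where

  mutual
    ⟦_⟧R : Role S Φ → Δ 𝓘 → Δ 𝓘 → Set
    ⟦ rname r ⟧R x y = role 𝓘 r x y
    ⟦ ε ⟧R x y = x ≡ y
    ⟦ R ∘ʳ R' ⟧R x z = Σ[ y ∈ Δ 𝓘 ] (⟦ R ⟧R x y × ⟦ R' ⟧R y z)
    ⟦ R ⊔ʳ R' ⟧R x y = ⟦ R ⟧R x y ⊎ ⟦ R' ⟧R x y
    ⟦ R *ʳ ⟧R x y = Star ⟦ R ⟧R x y
    ⟦ C ?ʳ ⟧R x y = (x ≡ y) × ⟦ C ⟧C x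
    ⟦ R ⁻ ⟧R x y = ⟦ R ⟧R y x
    ⟦ Uʳ ⟧R x y = ⊤

    ⟦_⟧C : Concept S Φ → Δ 𝓘 → Set
    ⟦ cname A ⟧C x = conc 𝓘 A x
    ⟦ ⊤ᶜ ⟧C x = ⊤
    ⟦ ⊥ᶜ ⟧C x = ⊥
    ⟦ ¬ᶜ C ⟧C x = ¬ ⟦ C ⟧C x
    ⟦ C ⊓ D ⟧C x = ⟦ C ⟧C x × ⟦ D ⟧C x
    ⟦ C ⊔ D ⟧C x = ⟦ C ⟧C x ⊎ ⟦ D ⟧C x
    ⟦ ∀ᶜ R C ⟧C x = ∀ y → ⟦ R ⟧R x y → ⟦ C ⟧C y
    ⟦ ∃ᶜ R C ⟧C x = Σ[ y ∈ Δ 𝓘 ] (⟦ R ⟧R x y × ⟦ C ⟧C y)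
    ⟦ nominal a ⟧C x = x ≡ ind 𝓘 a
    ⟦ ≥ᶜ n r C ⟧C x = AtLeast n (λ y → role 𝓘 r x y × ⟦ C ⟧C y)
    ⟦ ≤ᶜ n r C ⟧C x = ¬ AtLeast (suc n) (λ y → role 𝓘 r x y × ⟦ C ⟧C y)
    ⟦ ≥⁻ᶜ n r C ⟧C x = AtLeast n (λ y → role 𝓘 r y x × ⟦ C ⟧C y)
    ⟦ ≤⁻ᶜ n r C ⟧C x = ¬ AtLeast (suc n) (λ y → role 𝓘 r y x × ⟦ C ⟧C y)
    ⟦ ∃Self r ⟧C x = role 𝓘 r x x

  Sat : Assertion S Φ → Set
  Sat (C ⟨ a ⟩) = ⟦ C ⟧C (ind 𝓘 a)
  Sat (R ⟨ a , b ⟩) = ⟦ R ⟧R (ind 𝓘 a) (ind 𝓘 b)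
  Sat (¬ R ⟨ a , b ⟩) = ¬ ⟦ R ⟧R (ind 𝓘 a) (ind 𝓘 b)
  Sat (a ≐ b) = ind 𝓘 a ≡ ind 𝓘 b
  Sat (a ≉ b) = ¬ (ind 𝓘 a ≡ ind 𝓘 b)

  IsModel : ABox S Φ → Set
  IsModel 𝓐 = All Sat 𝓐

-- A bijection between the sets {y | P y} and {y' | P' y'} which is contained in Z.
-- (P, P' may be proof-relevant, so the map must not depend on the proof of P y.)
record BijIn {D D' : Set} (P : D → Set) (P' : D' → Set) (Z : D → D' → Set) : Set where
  field
    f      : (y : D) → P y → D'
    f-wd   : ∀ y (p q : P y) → f y p ≡ f y q
    f-into : ∀ y (p : P y) → P' (f y p)
    f-Z    : ∀ y (p : P y) → Z y (f y p)
    f-inj  : ∀ y z (p : P y) (q : P z) → f y p ≡ f z q → y ≡ z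
    f-surj : ∀ y' → P' y' → Σ[ y ∈ D ] Σ[ p ∈ P y ] (f y p ≡ y')

record IsBisim {S : Sig} (Φ : Frag) (𝓘 𝓘' : Interp S) (Z : Δ 𝓘 → Δ 𝓘' → Set) : Set where
  field
    B1  : ∀ a → Z (ind 𝓘 a) (ind 𝓘' a)
    B2  : ∀ {x x'} A → Z x x' → (conc 𝓘 A x → conc 𝓘' A x') × (conc 𝓘' A x' → conc 𝓘 A x)
    B3  : ∀ {x x' y} r → Z x x' → role 𝓘 r x y → Σ[ y' ∈ Δ 𝓘' ] (Z y y' × role 𝓘' r x' y')
    B4  : ∀ {x x' y'} r → Z x x' → role 𝓘' r x' y' → Σ[ y ∈ Δ 𝓘 ] (Z y y' × role 𝓘 r x y)
    B5  : T (hasI Φ) → ∀ {x x' y} r → Z x x' → role 𝓘 r y x → Σ[ y' ∈ Δ 𝓘' ] (Z y y' × role 𝓘' r y' x')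
    B6  : T (hasI Φ) → ∀ {x x' y'} r → Z x x' → role 𝓘' r y' x' → Σ[ y ∈ Δ 𝓘 ] (Z y y' × role 𝓘 r y x)
    B7  : T (hasO Φ) → ∀ {x x'} a → Z x x' → (x ≡ ind 𝓘 a → x' ≡ ind 𝓘' a) × (x' ≡ ind 𝓘' a → x ≡ ind 𝓘 a)
    B8  : T (hasQ Φ) → ∀ {x x'} r → Z x x' → BijIn (role 𝓘 r x) (role 𝓘' r x') Z
    B9  : T (hasQ Φ) → T (hasI Φ) → ∀ {x x'} r → Z x x' → BijIn (λ y → role 𝓘 r y x) (λ y' → role 𝓘' r y' x') Z
    B10 : T (hasU Φ) → ∀ x → Σ[ x' ∈ Δ 𝓘' ] Z x x'
    B11 : T (hasU Φ) → ∀ x' → Σ[ x ∈ Δ 𝓘 ] Z x x'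
    B12 : T (hasSelf Φ) → ∀ {x x'} r → Z x x' → (role 𝓘 r x x → role 𝓘' r x' x') × (role 𝓘' r x' x' → role 𝓘 r x x)

module Submission where

-- The heart of the proof is that every concept of L_Φ is preserved along an
-- L_Φ-bisimulation Z: if Z x x' and x ∈ Cᴵ then x' ∈ Cᴵ'.  Since the converse
-- relation of a bisimulation is again a bisimulation, this one direction
-- suffices, and it is proved by structural induction, simultaneously with the
-- "forth" property of roles: an R-step from x can be matched by an R-step
-- from x' ending in Z-related elements.  Every role constructor preserves the
-- forth property by a generic lemma about relations (composition, union,
-- reflexive-transitive closure, tests, the universal role); inverse roles
-- need the forth property of converse relations, which B5 provides.
-- Number restrictions are transported along the bijections of B8/B9.
--
-- For ABoxes, concept assertions C(a) transfer because Z relates a to a (B1).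
-- The remaining assertion kinds mention individuals in role or equality
-- positions; with nominals (B7) an element related to a is a itself, which
-- lets them transfer as well.

open import Defs
open import Data.Bool using (T)
open import Data.Unit using (⊤; tt)
open import Data.Product using (Σ-syntax; _×_; _,_; proj₁; proj₂)
open import Data.Sum using (_⊎_; inj₁; inj₂)
open import Data.List.Relation.Unary.All using (All)
import Data.List.Relation.Unary.All as All
open import Function using (flip)
open import Function.Bundles using (_⇔_; mk⇔)
open import Relation.Binary.PropositionalEquality using (_≡_; refl; sym; trans; subst)
open import Relation.Binary.Construct.Closure.ReflexiveTransitive using (Star; ε; _◅_; reverse)

Forth : {D D' : Set} → (D → D' → Set) → (D → D → Set) → (D' → D' → Set) → Set
Forth {D' = D'} Z R R' = ∀ {x x' y} → Z x x' → R x y → Σ[ y' ∈ D' ] (Z y y' × R' x' y')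

module _ {D D' : Set} {Z : D → D' → Set} where

  forth-≡ : Forth Z _≡_ _≡_
  forth-≡ {x' = x'} z refl = x' , z , refl

  forth-test : {P : D → Set} {P' : D' → Set} → (∀ {x x'} → Z x x' → P x → P' x') →
    Forth Z (λ x y → x ≡ y × P x) (λ x' y' → x' ≡ y' × P' x')
  forth-test pres {x' = x'} z (refl , p) = x' , z , refl , pres z p

  forth-total : (∀ y → Σ[ y' ∈ D' ] Z y y') → Forth Z (λ _ _ → ⊤) (λ _ _ → ⊤)
  forth-total total {y = y} _ _ = proj₁ (total y) , proj₂ (total y) , tt

  forth-flip : {R : D → D → Set} {R' : D' → D' → Set} →
    (∀ {x y} → R x y → R y x) → (∀ {x y} → R' x y → R' y x) →
    Forth Z R R' → Forth Z (flip R) (flip R')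
  forth-flip symR symR' fR z r with fR z (symR r)
  ... | y' , zy , r' = y' , zy , symR' r'

  module _ {R S : D → D → Set} {R' S' : D' → D' → Set} where

    forth-⊎ : Forth Z R R' → Forth Z S S' →
      Forth Z (λ x y → R x y ⊎ S x y) (λ x y → R' x y ⊎ S' x y)
    forth-⊎ fR fS z (inj₁ r) with fR z r
    ... | y' , zy , r' = y' , zy , inj₁ r'
    forth-⊎ fR fS z (inj₂ s) with fS z s
    ... | y' , zy , s' = y' , zy , inj₂ s'

    forth-∘ : Forth Z R R' → Forth Z S S' →
      Forth Z (λ x z → Σ[ y ∈ D ] (R x y × S y z)) (λ x z → Σ[ y ∈ D' ] (R' x y × S' y z))
    forth-∘ fR fS z (m , r , s) with fR z r
    ... | m' , zm , r' with fS zm s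
    ... | y' , zy , s' = y' , zy , (m' , r' , s')

    forth-∘⁻ : Forth Z (flip R) (flip R') → Forth Z (flip S) (flip S') →
      Forth Z (flip (λ x z → Σ[ y ∈ D ] (R x y × S y z)))
              (flip (λ x z → Σ[ y ∈ D' ] (R' x y × S' y z)))
    forth-∘⁻ fR fS z (m , r , s) with fS z s
    ... | m' , zm , s' with fR zm r
    ... | y' , zy , r' = y' , zy , (m' , r' , s')

  forth-star : {R : D → D → Set} {R' : D' → D' → Set} →
    Forth Z R R' → Forth Z (Star R) (Star R')
  forth-star fR {x' = x'} z ε = x' , z , ε
  forth-star fR z (r ◅ rs) with fR z r
  ... | m' , zm , r' with forth-star fR zm rs
  ... | y' , zy , rs' = y' , zy , (r' ◅ rs')

  -- Converse version: the closure of the converse is the converse of the closure.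
  forth-star⁻ : {R : D → D → Set} {R' : D' → D' → Set} →
    Forth Z (flip R) (flip R') → Forth Z (flip (Star R)) (flip (Star R'))
  forth-star⁻ fR z rs with forth-star fR z (reverse (λ r → r) rs)
  ... | y' , zy , rs' = y' , zy , reverse (λ r → r) rs'

BijIn-inverse : {D D' : Set} {P : D → Set} {P' : D' → Set} {Z : D → D' → Set} →
  BijIn P P' Z → BijIn P' P (flip Z)
BijIn-inverse {P = P} {P' = P'} {Z = Z} bij = record
  { f      = g
  ; f-wd   = λ y' p q → f-inj _ _ _ _ (trans (f-g y' p) (sym (f-g y' q)))
  ; f-into = λ y' p → proj₁ (proj₂ (f-surj y' p))
  ; f-Z    = λ y' p → subst (Z (g y' p)) (f-g y' p) (f-Z _ _)
  ; f-inj  = g-inj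
  ; f-surj = λ y p → f y p , f-into y p , f-inj _ _ _ _ (f-g (f y p) (f-into y p))
  }
  where
  open BijIn bij

  g : ∀ y' → P' y' → _
  g y' p = proj₁ (f-surj y' p)

  f-g : ∀ y' (p : P' y') → f (g y' p) (proj₁ (proj₂ (f-surj y' p))) ≡ y'
  f-g y' p = proj₂ (proj₂ (f-surj y' p))

  f-cong : ∀ {y z} → y ≡ z → (p : P y) (q : P z) → f y p ≡ f z q
  f-cong {y} refl p q = f-wd y p q

  g-inj : ∀ y z (p : P' y) (q : P' z) → g y p ≡ g z q → y ≡ z
  g-inj y z p q eq = trans (sym (f-g y p)) (trans (f-cong eq _ _) (f-g z q))

IsBisim-converse : ∀ {S Φ} {𝓘 𝓘' : Interp S} {Z : Δ 𝓘 → Δ 𝓘' → Set} →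
  IsBisim Φ 𝓘 𝓘' Z → IsBisim Φ 𝓘' 𝓘 (flip Z)
IsBisim-converse b = record
  { B1  = B1
  ; B2  = λ A z → swap (B2 A z)
  ; B3  = λ r z h → B4 r z h
  ; B4  = λ r z h → B3 r z h
  ; B5  = λ i r z h → B6 i r z h
  ; B6  = λ i r z h → B5 i r z h
  ; B7  = λ o a z → swap (B7 o a z)
  ; B8  = λ q r z → BijIn-inverse (B8 q r z)
  ; B9  = λ q i r z → BijIn-inverse (B9 q i r z)
  ; B10 = B11
  ; B11 = B10
  ; B12 = λ s r z → swap (B12 s r z)
  }
  where
  open IsBisim b
  swap : {A B : Set} → (A → B) × (B → A) → (B → A) × (A → B)
  swap (f , g) = g , f

AtLeast-transfer : ∀ {D D' : Set} {P Q : D → Set} {P' Q' : D' → Set} {Z : D → D' → Set} {n} →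
  BijIn P P' Z → (∀ {y y'} → Z y y' → Q y → Q' y') →
  AtLeast n (λ y → P y × Q y) → AtLeast n (λ y → P' y × Q' y)
AtLeast-transfer bij pres (h , h-inj , h-in) =
    (λ i → f (h i) (proj₁ (h-in i)))
  , (λ i j eq → h-inj i j (f-inj _ _ _ _ eq))
  , (λ i → f-into _ _ , pres (f-Z _ _) (proj₂ (h-in i)))
  where open BijIn bij

test-sym : {D : Set} {P : D → Set} {x y : D} → x ≡ y × P x → y ≡ x × P y
test-sym (refl , p) = refl , p

module _ {S : Sig} {Φ : Frag} where

  mutual
    role-forth : ∀ {𝓘 𝓘' : Interp S} {Z} → IsBisim Φ 𝓘 𝓘' Z → (R : Role S Φ) →
      Forth Z (⟦_⟧R 𝓘 R) (⟦_⟧R 𝓘' R)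
    role-forth b (rname r)    = IsBisim.B3 b r
    role-forth b ε            = forth-≡
    role-forth b (R ∘ʳ R')    = forth-∘ (role-forth b R) (role-forth b R')
    -- (for unions the relations are supplied, as they cannot be inferred)
    role-forth {𝓘} {𝓘'} b (R ⊔ʳ R') =
      forth-⊎ {R = ⟦_⟧R 𝓘 R} {⟦_⟧R 𝓘 R'} {⟦_⟧R 𝓘' R} {⟦_⟧R 𝓘' R'} (role-forth b R) (role-forth b R')
    role-forth b (R *ʳ)       = forth-star (role-forth b R)
    role-forth b (C ?ʳ)       = forth-test (concept-preserved b C)
    role-forth b (_⁻ R {i})   = role-forth⁻ i b R
    role-forth b (Uʳ {u})     = forth-total (IsBisim.B10 b u)

    role-forth⁻ : ∀ {𝓘 𝓘' : Interp S} {Z} → T (hasI Φ) → IsBisim Φ 𝓘 𝓘' Z → (R : Role S Φ) →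
      Forth Z (flip (⟦_⟧R 𝓘 R)) (flip (⟦_⟧R 𝓘' R))
    role-forth⁻ i b (rname r)  = IsBisim.B5 b i r
    role-forth⁻ {𝓘} {𝓘'} i b ε =
      forth-flip {R = ⟦_⟧R {Φ = Φ} 𝓘 ε} {R' = ⟦_⟧R {Φ = Φ} 𝓘' ε} sym sym (role-forth b ε)
    role-forth⁻ i b (R ∘ʳ R')  = forth-∘⁻ (role-forth⁻ i b R) (role-forth⁻ i b R')
    role-forth⁻ {𝓘} {𝓘'} i b (R ⊔ʳ R') =
      forth-⊎ {R = flip (⟦_⟧R 𝓘 R)} {flip (⟦_⟧R 𝓘 R')} {flip (⟦_⟧R 𝓘' R)} {flip (⟦_⟧R 𝓘' R')}
        (role-forth⁻ i b R) (role-forth⁻ i b R')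
    role-forth⁻ i b (R *ʳ)     = forth-star⁻ (role-forth⁻ i b R)
    role-forth⁻ {𝓘} {𝓘'} i b (C ?ʳ) =
      forth-flip {R = ⟦_⟧R 𝓘 (C ?ʳ)} {R' = ⟦_⟧R 𝓘' (C ?ʳ)} test-sym test-sym (role-forth b (C ?ʳ))
    role-forth⁻ i b (R ⁻)      = role-forth b R
    role-forth⁻ i b (Uʳ {u})   = forth-total (IsBisim.B10 b u)

    concept-preserved : ∀ {𝓘 𝓘' : Interp S} {Z} → IsBisim Φ 𝓘 𝓘' Z → (C : Concept S Φ) →
      ∀ {x x'} → Z x x' → ⟦_⟧C 𝓘 C x → ⟦_⟧C 𝓘' C x'
    concept-preserved b (cname A) z c = proj₁ (IsBisim.B2 b A z) c
    concept-preserved b ⊤ᶜ z c = tt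
    concept-preserved b ⊥ᶜ z ()
    concept-preserved b (¬ᶜ C) z c c' = c (concept-preserved (IsBisim-converse b) C z c')
    concept-preserved b (C ⊓ D) z (c , d) = concept-preserved b C z c , concept-preserved b D z d
    concept-preserved b (C ⊔ D) z (inj₁ c) = inj₁ (concept-preserved b C z c)
    concept-preserved b (C ⊔ D) z (inj₂ d) = inj₂ (concept-preserved b D z d)
    concept-preserved b (∀ᶜ R C) z c y' r' with role-forth (IsBisim-converse b) R z r'
    ... | y , zy , r = concept-preserved b C zy (c y r)
    concept-preserved b (∃ᶜ R C) z (y , r , c) with role-forth b R z r
    ... | y' , zy , r' = y' , r' , concept-preserved b C zy c
    concept-preserved b (nominal a {o}) z c = proj₁ (IsBisim.B7 b o a z) c
    concept-preserved b (≥ᶜ {q} n r C) z c =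
      AtLeast-transfer (IsBisim.B8 b q r z) (concept-preserved b C) c
    concept-preserved b (≤ᶜ {q} n r C) z c c' =
      c (AtLeast-transfer (IsBisim.B8 b' q r z) (concept-preserved b' C) c')
      where b' = IsBisim-converse b
    concept-preserved b (≥⁻ᶜ {q} {i} n r C) z c =
      AtLeast-transfer (IsBisim.B9 b q i r z) (concept-preserved b C) c
    concept-preserved b (≤⁻ᶜ {q} {i} n r C) z c c' =
      c (AtLeast-transfer (IsBisim.B9 b' q i r z) (concept-preserved b' C) c')
      where b' = IsBisim-converse b
    concept-preserved b (∃Self {s} r) z c = proj₁ (IsBisim.B12 b s r z) c

  module _ {𝓘 𝓘' : Interp S} {Z : Δ 𝓘 → Δ 𝓘' → Set} (b : IsBisim Φ 𝓘 𝓘' Z) where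

    concept-assertion-preserved : ∀ A → IsConceptAssertion S Φ A × Sat 𝓘 A → Sat 𝓘' A
    concept-assertion-preserved (C ⟨ a ⟩) (_ , c) = concept-preserved b C (IsBisim.B1 b a) c

    module _ (o : T (hasO Φ)) where

      named-partner : ∀ {a y'} → Z (ind 𝓘 a) y' → y' ≡ ind 𝓘' a
      named-partner {a} z = proj₁ (IsBisim.B7 b o a z) refl

      role-assertion-preserved : ∀ R {a c} → ⟦_⟧R 𝓘 R (ind 𝓘 a) (ind 𝓘 c) →
        ⟦_⟧R 𝓘' R (ind 𝓘' a) (ind 𝓘' c)
      role-assertion-preserved R {a} r with role-forth b R (IsBisim.B1 b a) r
      ... | y' , zy , r' = subst (⟦_⟧R 𝓘' R (ind 𝓘' a)) (named-partner zy) r'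

      equality-preserved : ∀ {a c} → ind 𝓘 a ≡ ind 𝓘 c → ind 𝓘' a ≡ ind 𝓘' c
      equality-preserved {a} {c} eq =
        sym (named-partner (subst (λ x → Z x (ind 𝓘' c)) (sym eq) (IsBisim.B1 b c)))

  -- With nominals every assertion is preserved; the negative assertion kinds
  -- follow from preservation of the positive ones along the converse.
  assertion-preserved : ∀ {𝓘 𝓘' : Interp S} {Z} → T (hasO Φ) → IsBisim Φ 𝓘 𝓘' Z →
    ∀ A → Sat 𝓘 A → Sat 𝓘' A
  assertion-preserved o b (C ⟨ a ⟩)   c   = concept-assertion-preserved b (C ⟨ a ⟩) (tt , c)
  assertion-preserved o b (_⟨_,_⟩ R a c) r = role-assertion-preserved b o R r
  assertion-preserved o b (¬_⟨_,_⟩ R a c) ¬r r' =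
    ¬r (role-assertion-preserved (IsBisim-converse b) o R r')
  assertion-preserved o b (a ≐ c)     eq  = equality-preserved b o eq
  assertion-preserved o b (a ≉ c)     neq eq' = neq (equality-preserved (IsBisim-converse b) o eq')

  model-preserved : ∀ (𝓐 : ABox S Φ) → T (hasO Φ) ⊎ All (IsConceptAssertion S Φ) 𝓐 →
    ∀ {𝓘 𝓘' : Interp S} {Z} → IsBisim Φ 𝓘 𝓘' Z → IsModel 𝓘 𝓐 → IsModel 𝓘' 𝓐
  model-preserved 𝓐 (inj₁ o)  b = All.map (λ {A} → assertion-preserved o b A)
  model-preserved 𝓐 (inj₂ cs) b sat = All.zipWith (λ {A} → concept-assertion-preserved b A) (cs , sat)

theorem3 : (S : Sig) (Φ : Frag) (𝓐 : ABox S Φ) →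
    T (hasO Φ) ⊎ All (IsConceptAssertion S Φ) 𝓐 →
    (𝓘 𝓘' : Interp S) (Z : Δ 𝓘 → Δ 𝓘' → Set) → IsBisim Φ 𝓘 𝓘' Z →
    IsModel 𝓘 𝓐 ⇔ IsModel 𝓘' 𝓐
theorem3 S Φ 𝓐 invariant 𝓘 𝓘' Z b =
  mk⇔ (model-preserved 𝓐 invariant b) (model-preserved 𝓐 invariant (IsBisim-converse b))
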